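{- Let $M$ be a square matrix with integer entries, and let $r_i$ and $r_j$ ($i\neq j$) be rows of $M$ with $r_i\neq r_j$ as vectors. Suppose that exactly $k$ rows of $M$ are equal to $r_j$ (so $M$ contains $k$ copies of $r_j$). Let $c$ be an integer and let $M'$ be the matrix obtained from $M$ by replacing row $r_i$ with $r_i+c\,r_j$. Then $\mathrm{Perm}(M)\equiv \mathrm{Perm}(M')\pmod{k+1}$.
   Context: The permanent of an $n\times n$ matrix $A=(a_{i,j})$ is $\mathrm{Perm}(A)=\sum_{\sigma\in S_n}\prod_{i=1}^n a_{i,\sigma(i)}$. -}

module Defs where

open import Data.Nat using (ℕ; zero; suc)
open import Data.Fin using (Fin; zero; suc; _≟_)
open import Data.Integer using (ℤ; _+_; _*_; _-_; +_)
open import Data.List using (List; []; _∷_; map; concatMap; allFin; filter; foldr; length)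
open import Data.Product using (_×_; _,_)
open import Relation.Binary.PropositionalEquality using (_≡_)
open import Relation.Nullary using (¬_; Dec; yes; no)
open import Relation.Nullary.Decidable using (¬?; _→-dec_)
open import Data.Fin.Properties using (all?)

Matrix : ℕ → Set
Matrix n = Fin n → Fin n → ℤ

allFuns : (m n : ℕ) → List (Fin m → Fin n)
allFuns zero    n = (λ ()) ∷ []
allFuns (suc m) n =
  concatMap (λ x → map (λ f → λ { zero → x ; (suc i) → f i }) (allFuns m n)) (allFin n)

Injective′ : ∀ {n} → (Fin n → Fin n) → Set
Injective′ {n} σ = ∀ i j → σ i ≡ σ j → i ≡ j

injective? : ∀ {n} (σ : Fin n → Fin n) → Dec (Injective′ σ)
injective? σ = all? λ i → all? λ j → (σ i ≟ σ j) →-dec (i ≟ j)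

-- S_n: the injective (equivalently bijective) self-maps of Fin n.
Sym : (n : ℕ) → List (Fin n → Fin n)
Sym n = filter injective? (allFuns n n)

sumL : List ℤ → ℤ
sumL = foldr _+_ (+ 0)

prodFin : ∀ n → (Fin n → ℤ) → ℤ
prodFin zero    f = + 1
prodFin (suc n) f = f zero * prodFin n (λ i → f (suc i))

Perm : ∀ {n} → Matrix n → ℤ
Perm {n} A = sumL (map (λ σ → prodFin n (λ i → A i (σ i))) (Sym n))

RowEq : ∀ {n} → (Fin n → ℤ) → (Fin n → ℤ) → Set
RowEq {n} r s = ∀ k → r k ≡ s k

rowEq? : ∀ {n} (r s : Fin n → ℤ) → Dec (RowEq r s)
rowEq? r s = all? λ k → r k Data.Integer.≟ s k

countRows : ∀ {n} → Matrix n → (Fin n → ℤ) → ℕ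
countRows {n} A r = length (filter (λ i → rowEq? (A i) r) (allFin n))

addRowMultiple : ∀ {n} → Matrix n → Fin n → Fin n → ℤ → Matrix n
addRowMultiple {n} A i j c p q with p ≟ i
... | yes _ = A i q + c * A j q
... | no  _ = A p q

module Submission where

-- Let N be M with row i replaced by r_j.  The permanent
-- is linear in each row, so  Perm M' = Perm M + c · Perm N,  and it suffices
-- to show that k+1 divides Perm N.  In N the rows indexed by
-- S = i ∷ [p | r_p = r_j] all coincide, and |S| = k+1 because r_i ≠ r_j.
-- For a matrix whose rows indexed by a duplicate-free list S coincide we show
-- |S| ∣ Perm: classify each permutation σ by its leader, the index t ∈ S sent
-- to the smallest column.  Precomposing with the transposition (s t) maps the
-- permutations led by t bijectively onto those led by s and preserves the
-- diagonal product (it only swaps equal rows), so all |S| classes contribute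
-- the same amount.
--
-- Permutations are the injective functions in the list of all functions
-- Fin n → Fin n, so the bijection is realised as the invariance of sums over
-- all functions under reindexing the domain by a permutation.

open import Defs
open import Algebra.Properties.CommutativeMonoid.Sum as MonoidSum using ()
open import Data.Bool using (Bool; true; false; if_then_else_)
open import Data.Empty using (⊥-elim)
open import Data.Fin using (Fin; zero; suc; toℕ; _≟_; _≤_; _≤?_)
open import Data.Fin.Permutation as Permutation using (Permutation′; _⟨$⟩ʳ_; _⟨$⟩ˡ_; inverseˡ; inverseʳ)
open import Data.Fin.Permutation.Components as Components using ()
open import Data.Fin.Properties as FP using ()
open import Data.Integer using (ℤ; _+_; _*_; _-_; +_; -_)
open import Data.Integer.Divisibility using (_∣_)
open import Data.Integer.Divisibility.Signed as Signed using (divides; ∣⇒∣ᵤ; ∣m⇒∣-m; ∣n⇒∣m*n)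
open import Data.Integer.Properties as ℤP using (+-identityˡ; +-identityʳ; +-assoc; *-zeroʳ; *-distribˡ-+; *-comm; pos-+)
open import Data.Integer.Tactic.RingSolver using (solve-∀)
open import Data.List using (List; []; _∷_; map; concatMap; concat; allFin; filter; length; _++_)
open import Data.List.Extrema.Nat using (argmin; argmin-sel; f[argmin]≤f[⊤]; f[argmin]≤f[xs])
open import Data.List.Membership.Propositional using (_∈_)
open import Data.List.Relation.Unary.All as All using (All; _∷_)
open import Data.List.Relation.Unary.All.Properties using (all-filter)
open import Data.List.Relation.Unary.AllPairs using (_∷_)
open import Data.List.Relation.Unary.Any using (here; there)
open import Data.List.Relation.Unary.Unique.Propositional using (Unique)
open import Data.List.Relation.Unary.Unique.Propositional.Properties using (filter⁺; allFin⁺)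
open import Data.Nat using (ℕ; zero; suc)
open import Data.Product using (_×_; _,_; ∃)
open import Data.Sum using (_⊎_; inj₁; inj₂; [_,_]′)
open import Data.Vec.Functional using (insertAt) renaming (_∷_ to _∷ᶠ_)
open import Data.Vec.Functional.Properties using (insertAt-lookup; insertAt-punchIn)
open import Function using (_∘_; _⇔_; mk⇔)
open import Relation.Binary.PropositionalEquality
open import Relation.Nullary using (¬_; Dec; yes; no; does)
open import Relation.Nullary.Decidable using (does-⇔)
open import Relation.Unary using (Decidable)

when : Bool → ℤ → ℤ
when b x = if b then x else + 0

when-zero : ∀ b → when b (+ 0) ≡ + 0
when-zero true  = refl
when-zero false = refl

sumOver : ∀ {a} {A : Set a} → List A → (A → ℤ) → ℤ
sumOver L F = sumL (map F L)

module _ {a} {A : Set a} where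

  sumOver-++ : ∀ (xs ys : List A) F → sumOver (xs ++ ys) F ≡ sumOver xs F + sumOver ys F
  sumOver-++ []       ys F = sym (+-identityˡ _)
  sumOver-++ (x ∷ xs) ys F = trans (cong (_+_ (F x)) (sumOver-++ xs ys F)) (sym (+-assoc (F x) _ _))

  sumOver-congIn : ∀ (L : List A) {F G : A → ℤ} → (∀ {x} → x ∈ L → F x ≡ G x) → sumOver L F ≡ sumOver L G
  sumOver-congIn []      eq = refl
  sumOver-congIn (x ∷ L) eq = cong₂ _+_ (eq (here refl)) (sumOver-congIn L (eq ∘ there))

  sumOver-cong : ∀ (L : List A) {F G : A → ℤ} → (∀ x → F x ≡ G x) → sumOver L F ≡ sumOver L G
  sumOver-cong L eq = sumOver-congIn L (λ {x} _ → eq x)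

  sumOver-+ : ∀ (L : List A) F G → sumOver L (λ x → F x + G x) ≡ sumOver L F + sumOver L G
  sumOver-+ []      F G = refl
  sumOver-+ (x ∷ L) F G = trans (cong (_+_ (F x + G x)) (sumOver-+ L F G)) (interchange (F x) (G x) _ _)
    where
    interchange : ∀ a b c d → a + b + (c + d) ≡ a + c + (b + d)
    interchange = solve-∀

  sumOver-* : ∀ (L : List A) c F → sumOver L (λ x → c * F x) ≡ c * sumOver L F
  sumOver-* []      c F = sym (*-zeroʳ c)
  sumOver-* (x ∷ L) c F = trans (cong (_+_ (c * F x)) (sumOver-* L c F)) (sym (*-distribˡ-+ c (F x) _))

  sumOver-zero : ∀ (L : List A) → sumOver L (λ _ → + 0) ≡ + 0
  sumOver-zero []      = refl
  sumOver-zero (x ∷ L) = trans (+-identityˡ _) (sumOver-zero L)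

  sumOver-const : ∀ (L : List A) X → sumOver L (λ _ → X) ≡ + length L * X
  sumOver-const []      X = refl
  sumOver-const (x ∷ L) X = begin
    X + sumOver L (λ _ → X)   ≡⟨ cong (_+_ X) (sumOver-const L X) ⟩
    X + + length L * X        ≡⟨ step X (+ length L) ⟩
    (+ 1 + + length L) * X    ≡⟨ cong (_* X) (pos-+ 1 (length L)) ⟨
    + suc (length L) * X      ∎
    where
    open ≡-Reasoning
    step : ∀ x m → x + m * x ≡ (+ 1 + m) * x
    step = solve-∀

  sumOver-filter : ∀ {p} {P : A → Set p} (P? : Decidable P) (L : List A) F →
                   sumOver (filter P? L) F ≡ sumOver L (λ x → when (does (P? x)) (F x))
  sumOver-filter P? []      F = refl
  sumOver-filter P? (x ∷ L) F with does (P? x)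
  ... | true  = cong (_+_ (F x)) (sumOver-filter P? L F)
  ... | false = trans (sumOver-filter P? L F) (sym (+-identityˡ _))

  sumOver-single : ∀ {q} {Q : A → Set q} (Q? : Decidable Q) (L : List A) → Unique L →
                   (∀ {a b} → a ∈ L → b ∈ L → Q a → Q b → a ≡ b) → (∃ λ t → t ∈ L × Q t) →
                   ∀ w → sumOver L (λ t → when (does (Q? t)) w) ≡ w
  sumOver-single Q? [] _ _ (_ , () , _) w
  sumOver-single Q? (x ∷ xs) (x∉xs ∷ distinct) unique (t , t∈ , Qt) w with Q? x
  ... | yes Qx = trans (cong (_+_ w) (trans (sumOver-congIn xs others-vanish) (sumOver-zero xs))) (+-identityʳ w)
    where
    others-vanish : ∀ {y} → y ∈ xs → when (does (Q? y)) w ≡ + 0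
    others-vanish {y} y∈ with Q? y
    ... | yes Qy = ⊥-elim (All.lookup x∉xs y∈ (unique (here refl) (there y∈) Qx Qy))
    ... | no _   = refl
  ... | no ¬Qx with t∈
  ...   | here refl = ⊥-elim (¬Qx Qt)
  ...   | there t∈xs = trans (+-identityˡ _)
    (sumOver-single Q? xs distinct (λ a∈ b∈ → unique (there a∈) (there b∈)) (t , t∈xs , Qt) w)

module _ {a b} {A : Set a} {B : Set b} where

  sumOver-map : ∀ (L : List A) (h : A → B) F → sumOver (map h L) F ≡ sumOver L (F ∘ h)
  sumOver-map []      h F = refl
  sumOver-map (x ∷ L) h F = cong (_+_ (F (h x))) (sumOver-map L h F)

  sumOver-concatMap : ∀ (L : List A) (g : A → List B) F →
                      sumOver (concatMap g L) F ≡ sumOver L (λ x → sumOver (g x) F)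
  sumOver-concatMap []      g F = refl
  sumOver-concatMap (x ∷ L) g F =
    trans (sumOver-++ (g x) (concat (map g L)) F) (cong (_+_ (sumOver (g x) F)) (sumOver-concatMap L g F))

  sumOver-swap : ∀ (L₁ : List A) (L₂ : List B) (F : A → B → ℤ) →
                 sumOver L₁ (λ x → sumOver L₂ (F x)) ≡ sumOver L₂ (λ y → sumOver L₁ (λ x → F x y))
  sumOver-swap []       L₂ F = sym (sumOver-zero L₂)
  sumOver-swap (x ∷ L₁) L₂ F =
    trans (cong (_+_ (sumOver L₂ (F x))) (sumOver-swap L₁ L₂ F)) (sym (sumOver-+ L₂ (F x) _))

sumFun : ∀ m n → ((Fin m → Fin n) → ℤ) → ℤ
sumFun m n H = sumOver (allFuns m n) H

-- H respects pointwise equality of functions; this replaces function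
-- extensionality, which is not available.
Extensional : ∀ {m n} → ((Fin m → Fin n) → ℤ) → Set
Extensional H = ∀ {f g} → (∀ i → f i ≡ g i) → H f ≡ H g

sumFun-cons : ∀ m n H → Extensional H → sumFun (suc m) n H ≡ sumOver (allFin n) (λ y → sumFun m n (λ f → H (y ∷ᶠ f)))
sumFun-cons m n H ext = trans (sumOver-concatMap (allFin n) _ H)
  (sumOver-cong (allFin n) λ y → trans (sumOver-map (allFuns m n) _ H)
    (sumOver-cong (allFuns m n) λ f → ext λ { zero → refl ; (suc i) → refl }))

insertAt-cong : ∀ {m n} {f g : Fin m → Fin n} → (∀ i → f i ≡ g i) → ∀ a y i → insertAt f a y i ≡ insertAt g a y i
insertAt-cong         eq zero    y zero    = refl
insertAt-cong         eq zero    y (suc i) = eq i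
insertAt-cong {suc m} eq (suc a) y zero    = eq zero
insertAt-cong {suc m} eq (suc a) y (suc i) = insertAt-cong (eq ∘ suc) a y i

sumFun-insertAt : ∀ m n (a : Fin (suc m)) H → Extensional H →
                  sumFun (suc m) n H ≡ sumOver (allFin n) (λ y → sumFun m n (λ g → H (insertAt g a y)))
sumFun-insertAt m n zero H ext = trans (sumFun-cons m n H ext)
  (sumOver-cong (allFin n) λ y → sumOver-cong (allFuns m n) λ g → ext λ { zero → refl ; (suc i) → refl })
sumFun-insertAt (suc m) n (suc a) H ext = begin
  sumFun (suc (suc m)) n H
    ≡⟨ sumFun-cons (suc m) n H ext ⟩
  sumOver (allFin n) (λ x → sumFun (suc m) n (λ f → H (x ∷ᶠ f)))
    ≡⟨ sumOver-cong (allFin n) (λ x → sumFun-insertAt m n a (λ f → H (x ∷ᶠ f)) (∷-ext x)) ⟩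
  sumOver (allFin n) (λ x → sumOver (allFin n) (λ y → sumFun m n (λ h → H (x ∷ᶠ insertAt h a y))))
    ≡⟨ sumOver-swap (allFin n) (allFin n) _ ⟩
  sumOver (allFin n) (λ y → sumOver (allFin n) (λ x → sumFun m n (λ h → H (x ∷ᶠ insertAt h a y))))
    ≡⟨ sumOver-cong (allFin n) (λ y → trans (sumFun-cons m n _ (ext ∘ λ eq → insertAt-cong eq (suc a) y))
          (sumOver-cong (allFin n) λ x → sumOver-cong (allFuns m n) λ h → ext λ { zero → refl ; (suc i) → refl })) ⟨
  sumOver (allFin n) (λ y → sumFun (suc m) n (λ g → H (insertAt g (suc a) y))) ∎
  where
  open ≡-Reasoning
  ∷-ext : ∀ x → Extensional (λ f → H (x ∷ᶠ f))
  ∷-ext x eq = ext λ { zero → refl ; (suc i) → eq i }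

sumFun-permute : ∀ m n (π : Permutation′ m) H → Extensional H →
                 sumFun m n H ≡ sumFun m n (λ f → H (f ∘ (π ⟨$⟩ʳ_)))
sumFun-permute zero    n π H ext = cong (_+ + 0) (ext λ ())
sumFun-permute (suc m) n π H ext = begin
  sumFun (suc m) n H
    ≡⟨ sumFun-cons m n H ext ⟩
  sumOver (allFin n) (λ y → sumFun m n (λ g → H (y ∷ᶠ g)))
    ≡⟨ sumOver-cong (allFin n) (λ y → sumFun-permute m n ρ (λ g → H (y ∷ᶠ g)) (∷-ext y)) ⟩
  sumOver (allFin n) (λ y → sumFun m n (λ g → H (y ∷ᶠ (g ∘ (ρ ⟨$⟩ʳ_)))))
    ≡⟨ sumOver-cong (allFin n) (λ y → sumOver-cong (allFuns m n) λ g → ext (insertAt-permute g y)) ⟨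
  sumOver (allFin n) (λ y → sumFun m n (λ g → H (insertAt g a y ∘ (π ⟨$⟩ʳ_))))
    ≡⟨ sumFun-insertAt m n a (λ f → H (f ∘ (π ⟨$⟩ʳ_))) (λ eq → ext (eq ∘ (π ⟨$⟩ʳ_))) ⟨
  sumFun (suc m) n (λ f → H (f ∘ (π ⟨$⟩ʳ_))) ∎
  where
  open ≡-Reasoning
  a : Fin (suc m)
  a = π ⟨$⟩ʳ zero
  ρ : Permutation′ m
  ρ = Permutation.remove zero π
  ∷-ext : ∀ y → Extensional (λ g → H (y ∷ᶠ g))
  ∷-ext y eq = ext λ { zero → refl ; (suc i) → eq i }
  insertAt-permute : ∀ g y p → insertAt g a y (π ⟨$⟩ʳ p) ≡ (y ∷ᶠ (g ∘ (ρ ⟨$⟩ʳ_))) p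
  insertAt-permute g y zero    = insertAt-lookup g a y
  insertAt-permute g y (suc p) =
    trans (cong (insertAt g a y) (Permutation.punchIn-permute π zero p)) (insertAt-punchIn g a y (ρ ⟨$⟩ʳ p))

prodFin-cong : ∀ n {f g : Fin n → ℤ} → (∀ i → f i ≡ g i) → prodFin n f ≡ prodFin n g
prodFin-cong zero    eq = refl
prodFin-cong (suc n) eq = cong₂ _*_ (eq zero) (prodFin-cong n (eq ∘ suc))

-- prodFin agrees with the library's iterated product in (ℤ, *, 1), whose
-- invariance under permutations is reused.
module Product = MonoidSum ℤP.*-1-commutativeMonoid

prodFin≡product : ∀ n (f : Fin n → ℤ) → prodFin n f ≡ Product.sum f
prodFin≡product zero    f = refl
prodFin≡product (suc n) f = cong (f zero *_) (prodFin≡product n (f ∘ suc))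

prodFin-permute : ∀ n (f : Fin n → ℤ) (π : Permutation′ n) → prodFin n f ≡ prodFin n (f ∘ (π ⟨$⟩ʳ_))
prodFin-permute n f π =
  trans (prodFin≡product n f) (trans (Product.sum-permute f π) (sym (prodFin≡product n _)))

prodFin-linear : ∀ n (f g h : Fin n → ℤ) (i : Fin n) c → f i ≡ g i + c * h i →
                 (∀ p → ¬ p ≡ i → f p ≡ g p) → (∀ p → ¬ p ≡ i → h p ≡ g p) →
                 prodFin n f ≡ prodFin n g + c * prodFin n h
prodFin-linear (suc n) f g h zero c fᵢ f≡g h≡g = begin
  f zero * prodFin n (f ∘ suc)
    ≡⟨ cong₂ _*_ fᵢ (prodFin-cong n λ p → f≡g (suc p) λ ()) ⟩
  (g zero + c * h zero) * prodFin n (g ∘ suc)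
    ≡⟨ distrib (g zero) c (h zero) _ ⟩
  g zero * prodFin n (g ∘ suc) + c * (h zero * prodFin n (g ∘ suc))
    ≡⟨ cong (λ z → g zero * prodFin n (g ∘ suc) + c * (h zero * z)) (prodFin-cong n λ p → h≡g (suc p) λ ()) ⟨
  g zero * prodFin n (g ∘ suc) + c * (h zero * prodFin n (h ∘ suc)) ∎
  where
  open ≡-Reasoning
  distrib : ∀ a c b P → (a + c * b) * P ≡ a * P + c * (b * P)
  distrib = solve-∀
prodFin-linear (suc n) f g h (suc i) c fᵢ f≡g h≡g = begin
  f zero * prodFin n (f ∘ suc)
    ≡⟨ cong₂ _*_ (f≡g zero λ ()) (prodFin-linear n (f ∘ suc) (g ∘ suc) (h ∘ suc) i c fᵢ (off-i f≡g) (off-i h≡g)) ⟩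
  g zero * (prodFin n (g ∘ suc) + c * prodFin n (h ∘ suc))
    ≡⟨ distrib (g zero) _ c _ ⟩
  g zero * prodFin n (g ∘ suc) + c * (g zero * prodFin n (h ∘ suc))
    ≡⟨ cong (λ z → g zero * prodFin n (g ∘ suc) + c * (z * prodFin n (h ∘ suc))) (h≡g zero λ ()) ⟨
  g zero * prodFin n (g ∘ suc) + c * (h zero * prodFin n (h ∘ suc)) ∎
  where
  open ≡-Reasoning
  distrib : ∀ x P c Q → x * (P + c * Q) ≡ x * P + c * (x * Q)
  distrib = solve-∀
  off-i : ∀ {u v : Fin (suc n) → ℤ} → (∀ p → ¬ p ≡ suc i → u p ≡ v p) → ∀ p → ¬ p ≡ i → u (suc p) ≡ v (suc p)
  off-i eq p p≢i = eq (suc p) (p≢i ∘ FP.suc-injective)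

injective-cong : ∀ {n} {f g : Fin n → Fin n} → (∀ i → f i ≡ g i) → Injective′ f → Injective′ g
injective-cong eq f-inj a b e = f-inj a b (trans (eq a) (trans e (sym (eq b))))

injective-∘-permutation : ∀ {n} (σ : Fin n → Fin n) (π : Permutation′ n) →
                          Injective′ σ ⇔ Injective′ (σ ∘ (π ⟨$⟩ʳ_))
injective-∘-permutation σ π = mk⇔
  (λ σ-inj a b e → trans (sym (inverseˡ π)) (trans (cong (π ⟨$⟩ˡ_) (σ-inj _ _ e)) (inverseˡ π)))
  (λ σπ-inj a b e → trans (sym (inverseʳ π)) (trans (cong (π ⟨$⟩ʳ_)
    (σπ-inj _ _ (trans (cong σ (inverseʳ π)) (trans e (sym (cong σ (inverseʳ π))))))) (inverseʳ π)))

Perm-cong : ∀ {n} {A B : Matrix n} → (∀ p q → A p q ≡ B p q) → Perm A ≡ Perm B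
Perm-cong {n} eq = sumOver-cong (Sym n) λ σ → prodFin-cong n λ p → eq p (σ p)

weight : ∀ {n} → Matrix n → (Fin n → Fin n) → ℤ
weight {n} A σ = when (does (injective? σ)) (prodFin n (λ p → A p (σ p)))

weight-ext : ∀ {n} (A : Matrix n) → Extensional (weight A)
weight-ext {n} A {f} {g} eq = cong₂ when
  (does-⇔ (mk⇔ (injective-cong eq) (injective-cong (sym ∘ eq))) (injective? f) (injective? g))
  (prodFin-cong n λ p → cong (A p) (eq p))

Perm≡sumFun : ∀ {n} (A : Matrix n) → Perm A ≡ sumFun n n (weight A)
Perm≡sumFun {n} A = sumOver-filter injective? (allFuns n n) _

weight-permute : ∀ {n} (A : Matrix n) (π : Permutation′ n) → (∀ p q → A (π ⟨$⟩ʳ p) q ≡ A p q) →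
                 ∀ σ → weight A (σ ∘ (π ⟨$⟩ʳ_)) ≡ weight A σ
weight-permute {n} A π rows σ = cong₂ when
  (sym (does-⇔ (injective-∘-permutation σ π) (injective? σ) (injective? (σ ∘ (π ⟨$⟩ʳ_)))))
  (trans (prodFin-cong n λ p → sym (rows p (σ (π ⟨$⟩ʳ p)))) (sym (prodFin-permute n (λ p → A p (σ p)) π)))

replaceRow : ∀ {n} → Matrix n → Fin n → (Fin n → ℤ) → Matrix n
replaceRow A i r p q with p ≟ i
... | yes _ = r q
... | no  _ = A p q

replaceRow-same : ∀ {n} (A : Matrix n) i r q → replaceRow A i r i q ≡ r q
replaceRow-same A i r q with i ≟ i
... | yes _   = refl
... | no  i≢i = ⊥-elim (i≢i refl)

replaceRow-other : ∀ {n} (A : Matrix n) i r p q → ¬ p ≡ i → replaceRow A i r p q ≡ A p q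
replaceRow-other A i r p q p≢i with p ≟ i
... | yes p≡i = ⊥-elim (p≢i p≡i)
... | no  _   = refl

Perm-linear : ∀ {n} (A : Matrix n) i (r s : Fin n → ℤ) c →
              Perm (replaceRow A i (λ q → r q + c * s q)) ≡ Perm (replaceRow A i r) + c * Perm (replaceRow A i s)
Perm-linear {n} A i r s c = begin
  sumOver (Sym n) (diagonal (replaceRow A i (λ q → r q + c * s q)))
    ≡⟨ sumOver-cong (Sym n) diagonal-linear ⟩
  sumOver (Sym n) (λ σ → diagonal (replaceRow A i r) σ + c * diagonal (replaceRow A i s) σ)
    ≡⟨ sumOver-+ (Sym n) _ _ ⟩
  Perm (replaceRow A i r) + sumOver (Sym n) (λ σ → c * diagonal (replaceRow A i s) σ)
    ≡⟨ cong (_+_ (Perm (replaceRow A i r))) (sumOver-* (Sym n) c _) ⟩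
  Perm (replaceRow A i r) + c * Perm (replaceRow A i s) ∎
  where
  open ≡-Reasoning
  diagonal : Matrix n → (Fin n → Fin n) → ℤ
  diagonal B σ = prodFin n (λ p → B p (σ p))
  diagonal-linear : ∀ σ → diagonal (replaceRow A i (λ q → r q + c * s q)) σ
                          ≡ diagonal (replaceRow A i r) σ + c * diagonal (replaceRow A i s) σ
  diagonal-linear σ = prodFin-linear n _ _ _ i c
    (trans (replaceRow-same A i _ (σ i))
      (sym (cong₂ (λ x y → x + c * y) (replaceRow-same A i r (σ i)) (replaceRow-same A i s (σ i)))))
    (λ p p≢i → trans (replaceRow-other A i _ p (σ p) p≢i) (sym (replaceRow-other A i r p (σ p) p≢i)))
    (λ p p≢i → trans (replaceRow-other A i s p (σ p) p≢i) (sym (replaceRow-other A i r p (σ p) p≢i)))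

transpose-cases : ∀ {n} (x y u : Fin n) →
                  (u ≡ x × Components.transpose x y u ≡ y) ⊎
                  (u ≡ y × Components.transpose x y u ≡ x) ⊎ Components.transpose x y u ≡ u
transpose-cases x y u with u ≟ x
... | yes u≡x = inj₁ (u≡x , refl)
... | no  _ with u ≟ y
...   | yes u≡y = inj₂ (inj₁ (u≡y , refl))
...   | no  _   = inj₂ (inj₂ refl)

transpose-left : ∀ {n} (x y : Fin n) → Components.transpose x y x ≡ y
transpose-left x y with x ≟ x
... | yes _   = refl
... | no  x≢x = ⊥-elim (x≢x refl)

transpose-∈ : ∀ {n} {x y u : Fin n} {L : List (Fin n)} → x ∈ L → y ∈ L → u ∈ L → Components.transpose x y u ∈ L
transpose-∈ {x = x} {y} {u} {L} x∈ y∈ u∈ with transpose-cases x y u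
... | inj₁ (_ , τu≡y)        = subst (_∈ L) (sym τu≡y) y∈
... | inj₂ (inj₁ (_ , τu≡x)) = subst (_∈ L) (sym τu≡x) x∈
... | inj₂ (inj₂ τu≡u)       = subst (_∈ L) (sym τu≡u) u∈

module RepeatedRows {n} (A : Matrix n) (s : Fin n) (rest : List (Fin n))
                    (distinct : Unique (s ∷ rest)) (equal : All (λ t → RowEq (A t) (A s)) rest) where

  S : List (Fin n)
  S = s ∷ rest

  equal-S : ∀ {t} → t ∈ S → RowEq (A t) (A s)
  equal-S (here refl) q = refl
  equal-S (there t∈)  = All.lookup equal t∈

  LedBy : (Fin n → Fin n) → Fin n → Set
  LedBy σ t = All (λ u → σ t ≤ σ u) S

  ledBy? : ∀ σ t → Dec (LedBy σ t)
  ledBy? σ t = All.all? (λ u → σ t ≤? σ u) S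

  leader-exists : ∀ σ → ∃ λ t → t ∈ S × LedBy σ t
  leader-exists σ = argmin rank s rest , leader∈S , f[argmin]≤f[⊤] {f = rank} s rest ∷ f[argmin]≤f[xs] {f = rank} s rest
    where
    rank : Fin n → ℕ
    rank = toℕ ∘ σ
    leader∈S : argmin rank s rest ∈ S
    leader∈S = [ (λ e → subst (_∈ S) (sym e) (here refl)) , there ]′ (argmin-sel rank s rest)

  leader-unique : ∀ {σ} → Injective′ σ → ∀ {a b} → a ∈ S → b ∈ S → LedBy σ a → LedBy σ b → a ≡ b
  leader-unique σ-inj a∈ b∈ led-a led-b = σ-inj _ _ (FP.≤-antisym (All.lookup led-a b∈) (All.lookup led-b a∈))

  ledBy-permute : (π : Permutation′ n) → (∀ {u} → u ∈ S → π ⟨$⟩ʳ u ∈ S) → (∀ {u} → u ∈ S → π ⟨$⟩ˡ u ∈ S) →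
                  ∀ σ u → LedBy (σ ∘ (π ⟨$⟩ʳ_)) u ⇔ LedBy σ (π ⟨$⟩ʳ u)
  ledBy-permute π πʳ∈ πˡ∈ σ u = mk⇔
    (λ led → All.tabulate λ v∈ → subst (λ w → σ (π ⟨$⟩ʳ u) ≤ σ w) (inverseʳ π) (All.lookup led (πˡ∈ v∈)))
    (λ led → All.tabulate λ v∈ → All.lookup led (πʳ∈ v∈))

  ledWeight : Fin n → (Fin n → Fin n) → ℤ
  ledWeight t σ = when (does (ledBy? σ t)) (weight A σ)

  ledWeight-ext : ∀ t → Extensional (ledWeight t)
  ledWeight-ext t {f} {g} eq = cong₂ when
    (does-⇔ (mk⇔ (led-cong eq) (led-cong (sym ∘ eq))) (ledBy? f t) (ledBy? g t)) (weight-ext A eq)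
    where
    led-cong : ∀ {f g} → (∀ i → f i ≡ g i) → LedBy f t → LedBy g t
    led-cong eq = All.map λ {u} → subst₂ _≤_ (eq t) (eq u)

  -- Every permutation has exactly one leader.
  weight-split : ∀ {σ} → weight A σ ≡ sumOver S (λ t → ledWeight t σ)
  weight-split {σ} = sym (split (injective? σ))
    where
    split : (σ-inj? : Dec (Injective′ σ)) → ∀ {w} →
            sumOver S (λ t → when (does (ledBy? σ t)) (when (does σ-inj?) w)) ≡ when (does σ-inj?) w
    split (yes σ-inj) = sumOver-single (ledBy? σ) S distinct (leader-unique σ-inj) (leader-exists σ) _
    split (no _)      = trans (sumOver-cong S λ t → when-zero (does (ledBy? σ t))) (sumOver-zero S)

  -- Swapping s with any t ∈ S turns the permutations led by t into those led
  -- by s, so every leader accounts for the same part of the permanent.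
  sumFun-ledWeight : ∀ {t} → t ∈ S → sumFun n n (ledWeight t) ≡ sumFun n n (ledWeight s)
  sumFun-ledWeight {t} t∈ = sym (trans (sumFun-permute n n τ (ledWeight s) (ledWeight-ext s))
                                       (sumOver-cong (allFuns n n) swap))
    where
    τ : Permutation′ n
    τ = Permutation.transpose s t
    τ-rows : ∀ p q → A (τ ⟨$⟩ʳ p) q ≡ A p q
    τ-rows p q with transpose-cases s t p
    ... | inj₁ (refl , τp≡t)        = trans (cong (λ z → A z q) τp≡t) (equal-S t∈ q)
    ... | inj₂ (inj₁ (refl , τp≡s)) = trans (cong (λ z → A z q) τp≡s) (sym (equal-S t∈ q))
    ... | inj₂ (inj₂ τp≡p)          = cong (λ z → A z q) τp≡p
    swap : ∀ σ → ledWeight s (σ ∘ (τ ⟨$⟩ʳ_)) ≡ ledWeight t σ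
    swap σ = cong₂ when
      (does-⇔ (subst (λ u → LedBy (σ ∘ (τ ⟨$⟩ʳ_)) s ⇔ LedBy σ u) (transpose-left s t)
                (ledBy-permute τ (transpose-∈ (here refl) t∈) (transpose-∈ t∈ (here refl)) σ s))
              (ledBy? (σ ∘ (τ ⟨$⟩ʳ_)) s) (ledBy? σ t))
      (weight-permute A τ τ-rows σ)

  Perm≡ : Perm A ≡ + length S * sumFun n n (ledWeight s)
  Perm≡ = begin
    Perm A                                               ≡⟨ Perm≡sumFun A ⟩
    sumFun n n (weight A)                                ≡⟨ sumOver-cong (allFuns n n) (λ _ → weight-split) ⟩
    sumFun n n (λ σ → sumOver S (λ t → ledWeight t σ))   ≡⟨ sumOver-swap (allFuns n n) S _ ⟩
    sumOver S (λ t → sumFun n n (ledWeight t))           ≡⟨ sumOver-congIn S sumFun-ledWeight ⟩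
    sumOver S (λ _ → sumFun n n (ledWeight s))           ≡⟨ sumOver-const S _ ⟩
    + length S * sumFun n n (ledWeight s)                ∎
    where open ≡-Reasoning

  length-divides-Perm : + length S Signed.∣ Perm A
  length-divides-Perm = divides (sumFun n n (ledWeight s)) (trans Perm≡ (*-comm (+ length S) _))

replaceRow-divides : ∀ {n} (M : Matrix n) (i : Fin n) (r : Fin n → ℤ) → ¬ RowEq (M i) r →
                     + suc (countRows M r) Signed.∣ Perm (replaceRow M i r)
replaceRow-divides {n} M i r rowᵢ≢r =
  RepeatedRows.length-divides-Perm (replaceRow M i r) i equalToR distinct equal
  where
  equalToR : List (Fin n)
  equalToR = filter (λ p → rowEq? (M p) r) (allFin n)
  ≢i : ∀ {p} → RowEq (M p) r → ¬ i ≡ p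
  ≢i rowₚ≡r refl = rowᵢ≢r rowₚ≡r
  distinct : Unique (i ∷ equalToR)
  distinct = All.map ≢i (all-filter _ (allFin n)) ∷ filter⁺ _ (allFin⁺ n)
  equal : All (λ p → RowEq (replaceRow M i r p) (replaceRow M i r i)) equalToR
  equal = All.map (λ {p} rowₚ≡r q → trans (replaceRow-other M i r p q (≢i rowₚ≡r ∘ sym))
                                          (trans (rowₚ≡r q) (sym (replaceRow-same M i r q))))
                  (all-filter _ (allFin n))

Perm-addRowMultiple : ∀ {n} (M : Matrix n) i j c → Perm (addRowMultiple M i j c) ≡ Perm M + c * Perm (replaceRow M i (M j))
Perm-addRowMultiple M i j c = begin
  Perm (addRowMultiple M i j c)                         ≡⟨ Perm-cong as-replaceRow ⟩
  Perm (replaceRow M i (λ q → M i q + c * M j q))       ≡⟨ Perm-linear M i (M i) (M j) c ⟩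
  Perm (replaceRow M i (M i)) + c * Perm (replaceRow M i (M j))
                                                        ≡⟨ cong (_+ c * Perm (replaceRow M i (M j))) (Perm-cong unchanged) ⟩
  Perm M + c * Perm (replaceRow M i (M j))              ∎
  where
  open ≡-Reasoning
  as-replaceRow : ∀ p q → addRowMultiple M i j c p q ≡ replaceRow M i (λ q → M i q + c * M j q) p q
  as-replaceRow p q with p ≟ i
  ... | yes _ = refl
  ... | no  _ = refl
  unchanged : ∀ p q → replaceRow M i (M i) p q ≡ M p q
  unchanged p q with p ≟ i
  ... | yes refl = refl
  ... | no  _    = refl

lemma2p5 : ∀ (n : ℕ) (M : Matrix n) (i j : Fin n) (k : ℕ) (c : ℤ)
    → ¬ i ≡ j
    → ¬ RowEq (M i) (M j)
    → countRows M (M j) ≡ k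
    → (+ (suc k)) ∣ (Perm M - Perm (addRowMultiple M i j c))
lemma2p5 n M i j k c _ rowᵢ≢rowⱼ refl = ∣⇒∣ᵤ (subst (+ suc k Signed.∣_) (sym difference) divisible)
  where
  N : Matrix n
  N = replaceRow M i (M j)
  difference : Perm M - Perm (addRowMultiple M i j c) ≡ - (c * Perm N)
  difference = trans (cong (_-_ (Perm M)) (Perm-addRowMultiple M i j c)) (cancel (Perm M) (c * Perm N))
    where
    cancel : ∀ a b → a - (a + b) ≡ - b
    cancel = solve-∀
  divisible : + suc k Signed.∣ - (c * Perm N)
  divisible = ∣m⇒∣-m (∣n⇒∣m*n c (replaceRow-divides M i (M j) rowᵢ≢rowⱼ))
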